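{- Let $\Gamma$ be a finite simple $k$-regular graph with $N$ vertices, let $\mathcal{P}=\{V_1,\dots,V_n\}$ be an equitable partition of the vertices of $\Gamma$ such that the orbigraph $\Gamma/\mathcal{P}$ is connected, and let $P=\frac1k B$, where $B$ is the adjacency matrix of $\Gamma/\mathcal{P}$. Then the stationary distribution of $P$ is the $n$-tuple $\pi$ with $\pi_i=\frac{|V_i|}{N}$ for $i=1,\dots,n$.
   Context: A simple $k$-regular graph is regarded as a weighted directed graph by replacing each edge $\{u,v\}$ with directed edges $(u,v)$, $(v,u)$ of weight $1$. For a weighted directed graph with weight function $w$, a vertex partition $\mathcal{P}=\{V_1,\dots,V_n\}$ is equitable if for all $i,j$ the quantity $\sum_{v\in V_j}w(u,v)$ is the same for all $u\in V_i$; the quotient $\Gamma/\mathcal{P}$ is the weighted directed graph on $n$ vertices with adjacency matrix $B_{ij}=\sum_{v\in V_j}w(u,v)$ for any $u\in V_i$. The quotient is a $k$-orbigraph: $B_{ij}\in\mathbb{Z}_{\ge0}$, $\sum_jB_{ij}=k$, and $B_{ij}>0$ iff $B_{ji}>0$; it is connected if its underlying graph is connected. A stationary distribution of the stochastic matrix $P$ is a vector $\pi$ with nonnegative entries summing to $1$ and $\pi P=\pi$. -}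

module Defs where

open import Data.Nat using (ℕ; zero; suc; _+_; _<_; NonZero)
open import Data.Fin using (Fin; zero; suc; _≟_)
open import Data.Bool using (Bool; true; false; _∧_; if_then_else_)
open import Data.Integer using (+_)
open import Data.Rational using (ℚ; _/_; 0ℚ; 1ℚ; _≤_) renaming (_+_ to _+ℚ_; _*_ to _*ℚ_)
open import Data.Product using (_×_)
open import Relation.Nullary.Decidable using (⌊_⌋)
open import Relation.Binary.PropositionalEquality using (_≡_)

count : ∀ {m} → (Fin m → Bool) → ℕ
count {zero}  p = 0
count {suc m} p = (if p zero then 1 else 0) + count (λ i → p (suc i))

sumℚ : ∀ {m} → (Fin m → ℚ) → ℚ
sumℚ {zero}  f = 0ℚ
sumℚ {suc m} f = f zero +ℚ sumℚ (λ i → f (suc i))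

record SimpleGraph (N : ℕ) : Set where
  field
    adj       : Fin N → Fin N → Bool
    symmetric : ∀ u v → adj u v ≡ adj v u
    loopless  : ∀ u → adj u u ≡ false
open SimpleGraph public

degree : ∀ {N} → SimpleGraph N → Fin N → ℕ
degree G u = count (adj G u)

IsRegular : ∀ {N} → SimpleGraph N → ℕ → Set
IsRegular G k = ∀ u → degree G u ≡ k

-- A partition of Fin N into n nonempty blocks V_i = { v | part v ≡ i };
-- rep i is a chosen element of V_i (witnessing nonemptiness).
record Partition (N n : ℕ) : Set where
  field
    part   : Fin N → Fin n
    rep    : Fin n → Fin N
    rep-in : ∀ i → part (rep i) ≡ i
open Partition public

blockSize : ∀ {N n} → Partition N n → Fin n → ℕ
blockSize 𝒫 i = count (λ v → ⌊ part 𝒫 v ≟ i ⌋)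

nbrsIn : ∀ {N n} → SimpleGraph N → Partition N n → Fin N → Fin n → ℕ
nbrsIn G 𝒫 u j = count (λ v → adj G u v ∧ ⌊ part 𝒫 v ≟ j ⌋)

IsEquitable : ∀ {N n} → SimpleGraph N → Partition N n → Set
IsEquitable G 𝒫 = ∀ u u' → part 𝒫 u ≡ part 𝒫 u' → ∀ j → nbrsIn G 𝒫 u j ≡ nbrsIn G 𝒫 u' j

-- adjacency matrix of the quotient Γ/𝒫 : B_ij = Σ_{v∈V_j} w(u,v) for u ∈ V_i
quotientAdj : ∀ {N n} → SimpleGraph N → Partition N n → Fin n → Fin n → ℕ
quotientAdj G 𝒫 i j = nbrsIn G 𝒫 (rep 𝒫 i) j

data Reach {n : ℕ} (B : Fin n → Fin n → ℕ) : Fin n → Fin n → Set where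
  here : ∀ {i} → Reach B i i
  step : ∀ {i j l} → 0 < B i j → Reach B j l → Reach B i l

IsConnected : ∀ {n} → (Fin n → Fin n → ℕ) → Set
IsConnected {n} B = ∀ i j → Reach B i j

transitionMatrix : ∀ {n} (k : ℕ) .{{_ : NonZero k}} → (Fin n → Fin n → ℕ) → Fin n → Fin n → ℚ
transitionMatrix k B i j = (+ B i j) / k

IsStationary : ∀ {n} → (Fin n → Fin n → ℚ) → (Fin n → ℚ) → Set
IsStationary P π =
  (∀ i → 0ℚ ≤ π i) × (sumℚ π ≡ 1ℚ) × (∀ j → sumℚ (λ i → π i *ℚ P i j) ≡ π j)

-- Double counting the edges between two blocks gives the detailed balance
-- |V_i| B_ij = |V_j| B_ji, so the block sizes form an invariant measure of the
-- walk P = B/k and their normalisation is stationary. Conversely, for a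
-- stationary π the density x_i = π_i/|V_i| is harmonic (Bx = kx); by the
-- maximum principle a harmonic function is constant on a connected graph, so
-- π is proportional to the block sizes.
module Submission where

open import Defs
open import Data.Nat using (ℕ; NonZero)
open import Data.Fin using (Fin)
open import Data.Integer using (+_)
open import Data.Rational using (ℚ; _/_)
open import Data.Product using (_×_)
open import Relation.Binary.PropositionalEquality using (_≡_)

import Algebra.Properties.CommutativeSemigroup as CommutativeSemigroupProperties
import Algebra.Properties.Ring as RingProperties
import Algebra.Properties.Semiring.Sum as SemiringSum
open import Algebra.Bundles using (CommutativeMonoid; CommutativeRing)
open import Data.Bool using (Bool; true; false; _∧_; if_then_else_)
open import Data.Fin using (zero; suc; _≟_)
import Data.Integer as ℤ
import Data.Integer.Properties as ℤ
open import Data.List using (allFin)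
open import Data.List.Membership.Propositional.Properties using (∈-allFin)
import Data.List.Extrema
open import Data.List.Relation.Unary.All using (lookup)
open import Data.Nat using (zero; suc)
import Data.Nat as ℕ
import Data.Nat.Properties as ℕ
import Data.Rational as ℚ
import Data.Rational.Properties as ℚ
import Data.Rational.Solver
import Data.Rational.Unnormalised as ℚᵘ
import Data.Rational.Unnormalised.Properties as ℚᵘ
open import Data.Product using (_,_)
open import Function using (_∘_)
open import Relation.Binary.Bundles using (DecTotalOrder)
open import Relation.Binary.PropositionalEquality
  using (refl; sym; trans; cong; cong₂; subst; module ≡-Reasoning)
open import Relation.Nullary.Decidable using (⌊_⌋; yes; no; isYes≗does; dec-true)

module ℕΣ = SemiringSum ℕ.+-*-semiring
module ℚΣ = SemiringSum (CommutativeRing.semiring ℚ.+-*-commutativeRing)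
module ℕ* = CommutativeSemigroupProperties ℕ.*-commutativeSemigroup
module ℚ* = CommutativeSemigroupProperties (CommutativeMonoid.commutativeSemigroup ℚ.*-1-commutativeMonoid)
open ℕΣ using () renaming (sum to ∑ℕ)
open ℚΣ using () renaming (sum to ∑ℚ)

indicator : Bool → ℕ
indicator b = if b then 1 else 0

sumℚ≡∑ℚ : ∀ {m} (f : Fin m → ℚ) → sumℚ f ≡ ∑ℚ f
sumℚ≡∑ℚ {zero}  f = refl
sumℚ≡∑ℚ {suc m} f = cong (ℚ._+_ (f zero)) (sumℚ≡∑ℚ (f ∘ suc))

module _ where
  open import Data.Nat using (_+_; _*_; _≤_; _<_)
  open ≡-Reasoning

  count≡∑ℕ : ∀ {m} (p : Fin m → Bool) → count p ≡ ∑ℕ (indicator ∘ p)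
  count≡∑ℕ {zero}  p = refl
  count≡∑ℕ {suc m} p = cong (_+_ (indicator (p zero))) (count≡∑ℕ (p ∘ suc))

  indicator-∧ : ∀ a b → indicator (a ∧ b) ≡ indicator a * indicator b
  indicator-∧ true  b = sym (ℕ.*-identityˡ _)
  indicator-∧ false b = refl

  ∑ℕ-const-1 : ∀ m → ∑ℕ {m} (λ _ → 1) ≡ m
  ∑ℕ-const-1 zero    = refl
  ∑ℕ-const-1 (suc m) = cong suc (∑ℕ-const-1 m)

  term≤∑ℕ : ∀ {m} (f : Fin m → ℕ) i → f i ≤ ∑ℕ f
  term≤∑ℕ f zero    = ℕ.m≤m+n (f zero) _
  term≤∑ℕ f (suc i) = ℕ.≤-trans (term≤∑ℕ (f ∘ suc) i) (ℕ.m≤n+m _ (f zero))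

  ∑ℕ-indicator-≟ : ∀ {m} (x : Fin m) → ∑ℕ (λ j → indicator ⌊ x ≟ j ⌋) ≡ 1
  ∑ℕ-indicator-≟ {suc m} zero    = cong suc (ℕΣ.sum-replicate-zero m)
  ∑ℕ-indicator-≟ {suc m} (suc x) = trans (ℕΣ.sum-cong-≗ suc≟suc) (∑ℕ-indicator-≟ x)
    where
    suc≟suc : ∀ j → indicator ⌊ suc x ≟ suc j ⌋ ≡ indicator ⌊ x ≟ j ⌋
    suc≟suc j = cong indicator (trans (isYes≗does (suc x ≟ suc j)) (sym (isYes≗does (x ≟ j))))

  module _ {N n : ℕ} (𝒫 : Partition N n) where

    inBlock : Fin N → Fin n → ℕ
    inBlock v i = indicator ⌊ part 𝒫 v ≟ i ⌋

    blockSize≡∑ℕ : ∀ i → blockSize 𝒫 i ≡ ∑ℕ (λ v → inBlock v i)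
    blockSize≡∑ℕ i = count≡∑ℕ (λ v → ⌊ part 𝒫 v ≟ i ⌋)

    ∑ℕ-blockSize : ∑ℕ (blockSize 𝒫) ≡ N
    ∑ℕ-blockSize = begin
      ∑ℕ (blockSize 𝒫)                      ≡⟨ ℕΣ.sum-cong-≗ blockSize≡∑ℕ ⟩
      ∑ℕ (λ i → ∑ℕ (λ v → inBlock v i))    ≡⟨ ℕΣ.∑-comm (λ i v → inBlock v i) ⟩
      ∑ℕ (λ v → ∑ℕ (inBlock v))            ≡⟨ ℕΣ.sum-cong-≗ (∑ℕ-indicator-≟ ∘ part 𝒫) ⟩
      ∑ℕ {N} (λ _ → 1)                     ≡⟨ ∑ℕ-const-1 N ⟩
      N                                    ∎

    blockSize-nonZero : ∀ i → NonZero (blockSize 𝒫 i)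
    blockSize-nonZero i = ℕ.>-nonZero (ℕ.≤-trans rep∈Vᵢ (ℕ.≤-reflexive (sym (blockSize≡∑ℕ i))))
      where
      rep∈Vᵢ : 0 < ∑ℕ (λ v → inBlock v i)
      rep∈Vᵢ = subst (_≤ ∑ℕ (λ v → inBlock v i))
        (cong indicator (trans (isYes≗does _) (dec-true (part 𝒫 (rep 𝒫 i) ≟ i) (rep-in 𝒫 i))))
        (term≤∑ℕ (λ v → inBlock v i) (rep 𝒫 i))

  module _ {N n : ℕ} (G : SimpleGraph N) (𝒫 : Partition N n) where

    edge : Fin N → Fin N → ℕ
    edge u v = indicator (adj G u v)

    nbrsIn≡∑ℕ : ∀ u j → nbrsIn G 𝒫 u j ≡ ∑ℕ (λ v → edge u v * inBlock 𝒫 v j)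
    nbrsIn≡∑ℕ u j = trans (count≡∑ℕ (λ v → adj G u v ∧ ⌊ part 𝒫 v ≟ j ⌋))
      (ℕΣ.sum-cong-≗ (λ v → indicator-∧ (adj G u v) ⌊ part 𝒫 v ≟ j ⌋))

    ∑ℕ-nbrsIn : ∀ u → ∑ℕ (nbrsIn G 𝒫 u) ≡ degree G u
    ∑ℕ-nbrsIn u = begin
      ∑ℕ (nbrsIn G 𝒫 u)                                  ≡⟨ ℕΣ.sum-cong-≗ (nbrsIn≡∑ℕ u) ⟩
      ∑ℕ (λ j → ∑ℕ (λ v → edge u v * inBlock 𝒫 v j))    ≡⟨ ℕΣ.∑-comm (λ j v → edge u v * inBlock 𝒫 v j) ⟩
      ∑ℕ (λ v → ∑ℕ (λ j → edge u v * inBlock 𝒫 v j))    ≡⟨ ℕΣ.sum-cong-≗ (λ v → sym (ℕΣ.*-distribˡ-sum (edge u v) (inBlock 𝒫 v))) ⟩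
      ∑ℕ (λ v → edge u v * ∑ℕ (inBlock 𝒫 v))            ≡⟨ ℕΣ.sum-cong-≗ (λ v → cong (edge u v *_) (∑ℕ-indicator-≟ (part 𝒫 v))) ⟩
      ∑ℕ (λ v → edge u v * 1)                            ≡⟨ ℕΣ.sum-cong-≗ (λ v → ℕ.*-identityʳ (edge u v)) ⟩
      ∑ℕ (edge u)                                        ≡⟨ count≡∑ℕ (adj G u) ⟨
      degree G u                                         ∎

    quotientAdj-rowSum : ∀ {k} → IsRegular G k → ∀ i → ∑ℕ (quotientAdj G 𝒫 i) ≡ k
    quotientAdj-rowSum regular i = trans (∑ℕ-nbrsIn (rep 𝒫 i)) (regular (rep 𝒫 i))

    edgesBetween : Fin n → Fin n → ℕ
    edgesBetween i j = ∑ℕ λ u → ∑ℕ λ v → inBlock 𝒫 u i * (edge u v * inBlock 𝒫 v j)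

    edgesBetween-comm : ∀ i j → edgesBetween i j ≡ edgesBetween j i
    edgesBetween-comm i j =
      trans (ℕΣ.sum-cong-≗ (λ u → ℕΣ.sum-cong-≗ (reverse u))) (ℕΣ.∑-comm (λ u v → inBlock 𝒫 v j * (edge v u * inBlock 𝒫 u i)))
      where
      reverse : ∀ u v → inBlock 𝒫 u i * (edge u v * inBlock 𝒫 v j)
                      ≡ inBlock 𝒫 v j * (edge v u * inBlock 𝒫 u i)
      reverse u v = begin
        inBlock 𝒫 u i * (edge u v * inBlock 𝒫 v j)  ≡⟨ cong (λ e → inBlock 𝒫 u i * (e * inBlock 𝒫 v j)) (cong indicator (symmetric G u v)) ⟩
        inBlock 𝒫 u i * (edge v u * inBlock 𝒫 v j)  ≡⟨ ℕ*.x∙yz≈z∙yx (inBlock 𝒫 u i) (edge v u) (inBlock 𝒫 v j) ⟩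
        inBlock 𝒫 v j * (edge v u * inBlock 𝒫 u i)  ∎

    blockSize*quotientAdj≡edgesBetween : IsEquitable G 𝒫 → ∀ i j →
      blockSize 𝒫 i * quotientAdj G 𝒫 i j ≡ edgesBetween i j
    blockSize*quotientAdj≡edgesBetween equitable i j = begin
      blockSize 𝒫 i * Bᵢⱼ                                   ≡⟨ cong (_* Bᵢⱼ) (blockSize≡∑ℕ 𝒫 i) ⟩
      ∑ℕ (λ u → inBlock 𝒫 u i) * Bᵢⱼ                        ≡⟨ ℕΣ.*-distribʳ-sum Bᵢⱼ (λ u → inBlock 𝒫 u i) ⟩
      ∑ℕ (λ u → inBlock 𝒫 u i * Bᵢⱼ)                        ≡⟨ ℕΣ.sum-cong-≗ members ⟩
      ∑ℕ (λ u → inBlock 𝒫 u i * nbrsIn G 𝒫 u j)             ≡⟨ ℕΣ.sum-cong-≗ (λ u → cong (inBlock 𝒫 u i *_) (nbrsIn≡∑ℕ u j)) ⟩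
      ∑ℕ (λ u → inBlock 𝒫 u i * ∑ℕ (λ v → edge u v * inBlock 𝒫 v j)) ≡⟨ ℕΣ.sum-cong-≗ (λ u → ℕΣ.*-distribˡ-sum (inBlock 𝒫 u i) (λ v → edge u v * inBlock 𝒫 v j)) ⟩
      edgesBetween i j                                       ∎
      where
      Bᵢⱼ : ℕ
      Bᵢⱼ = quotientAdj G 𝒫 i j
      members : ∀ u → inBlock 𝒫 u i * Bᵢⱼ ≡ inBlock 𝒫 u i * nbrsIn G 𝒫 u j
      members u with part 𝒫 u ≟ i
      ... | yes u∈Vᵢ = cong (1 *_) (equitable (rep 𝒫 i) u (trans (rep-in 𝒫 i) (sym u∈Vᵢ)) j)
      ... | no  _    = refl

    quotientAdj-reversible : IsEquitable G 𝒫 → ∀ i j →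
      blockSize 𝒫 i * quotientAdj G 𝒫 i j ≡ blockSize 𝒫 j * quotientAdj G 𝒫 j i
    quotientAdj-reversible equitable i j = begin
      blockSize 𝒫 i * quotientAdj G 𝒫 i j  ≡⟨ blockSize*quotientAdj≡edgesBetween equitable i j ⟩
      edgesBetween i j                     ≡⟨ edgesBetween-comm i j ⟩
      edgesBetween j i                     ≡⟨ blockSize*quotientAdj≡edgesBetween equitable j i ⟨
      blockSize 𝒫 j * quotientAdj G 𝒫 j i  ∎

module _ where
  open import Data.Rational using (_+_; _*_; _-_; 1/_; 0ℚ; 1ℚ; _≤_)
  open RingProperties ℚ.+-*-ring using (+-identityˡ-unique; x∙y⁻¹≈ε⇒x≈y)

  fromℕ : ℕ → ℚ
  fromℕ a = + a / 1

  toℚᵘ-fromℕ : ∀ a → ℚ.toℚᵘ (fromℕ a) ℚᵘ.≃ ℚᵘ.mkℚᵘ (+ a) 0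
  toℚᵘ-fromℕ a = ℚ.toℚᵘ-fromℚᵘ (ℚᵘ.mkℚᵘ (+ a) 0)

  fromℕ-+ : ∀ a b → fromℕ (a ℕ.+ b) ≡ fromℕ a + fromℕ b
  fromℕ-+ a b = ℚ.toℚᵘ-injective (begin
    ℚ.toℚᵘ (fromℕ (a ℕ.+ b))                    ≈⟨ toℚᵘ-fromℕ (a ℕ.+ b) ⟩
    ℚᵘ.mkℚᵘ (+ (a ℕ.+ b)) 0                     ≈⟨ ℚᵘ.≃-reflexive (cong (λ c → ℚᵘ.mkℚᵘ c 0) numerator) ⟩
    ℚᵘ.mkℚᵘ (+ a) 0 ℚᵘ.+ ℚᵘ.mkℚᵘ (+ b) 0        ≈⟨ ℚᵘ.+-cong (toℚᵘ-fromℕ a) (toℚᵘ-fromℕ b) ⟨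
    ℚ.toℚᵘ (fromℕ a) ℚᵘ.+ ℚ.toℚᵘ (fromℕ b)      ≈⟨ ℚ.toℚᵘ-homo-+ (fromℕ a) (fromℕ b) ⟨
    ℚ.toℚᵘ (fromℕ a + fromℕ b)                  ∎)
    where
    open ℚᵘ.≃-Reasoning
    numerator : + (a ℕ.+ b) ≡ + a ℤ.* + 1 ℤ.+ + b ℤ.* + 1
    numerator = trans (ℤ.pos-+ a b) (sym (cong₂ ℤ._+_ (ℤ.*-identityʳ (+ a)) (ℤ.*-identityʳ (+ b))))

  fromℕ-* : ∀ a b → fromℕ (a ℕ.* b) ≡ fromℕ a * fromℕ b
  fromℕ-* a b = ℚ.toℚᵘ-injective (begin
    ℚ.toℚᵘ (fromℕ (a ℕ.* b))                    ≈⟨ toℚᵘ-fromℕ (a ℕ.* b) ⟩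
    ℚᵘ.mkℚᵘ (+ (a ℕ.* b)) 0                     ≈⟨ ℚᵘ.≃-reflexive (cong (λ c → ℚᵘ.mkℚᵘ c 0) (ℤ.pos-* a b)) ⟩
    ℚᵘ.mkℚᵘ (+ a) 0 ℚᵘ.* ℚᵘ.mkℚᵘ (+ b) 0        ≈⟨ ℚᵘ.*-cong (toℚᵘ-fromℕ a) (toℚᵘ-fromℕ b) ⟨
    ℚ.toℚᵘ (fromℕ a) ℚᵘ.* ℚ.toℚᵘ (fromℕ b)      ≈⟨ ℚ.toℚᵘ-homo-* (fromℕ a) (fromℕ b) ⟨
    ℚ.toℚᵘ (fromℕ a * fromℕ b)                  ∎)
    where open ℚᵘ.≃-Reasoning

  /-*-fromℕ : ∀ a d .{{_ : NonZero d}} → (+ a / d) * fromℕ d ≡ fromℕ a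
  /-*-fromℕ a (suc d) = ℚ.toℚᵘ-injective (begin
    ℚ.toℚᵘ ((+ a / suc d) * fromℕ (suc d))                 ≈⟨ ℚ.toℚᵘ-homo-* (+ a / suc d) (fromℕ (suc d)) ⟩
    ℚ.toℚᵘ (+ a / suc d) ℚᵘ.* ℚ.toℚᵘ (fromℕ (suc d))       ≈⟨ ℚᵘ.*-cong (ℚ.toℚᵘ-fromℚᵘ (ℚᵘ.mkℚᵘ (+ a) d)) (toℚᵘ-fromℕ (suc d)) ⟩
    ℚᵘ.mkℚᵘ (+ a) d ℚᵘ.* ℚᵘ.mkℚᵘ (+ suc d) 0              ≈⟨ ℚᵘ.*≡* cross ⟩
    ℚᵘ.mkℚᵘ (+ a) 0                                       ≈⟨ toℚᵘ-fromℕ a ⟨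
    ℚ.toℚᵘ (fromℕ a)                                      ∎)
    where
    open ℚᵘ.≃-Reasoning
    cross : (+ a ℤ.* + suc d) ℤ.* + 1 ≡ + a ℤ.* + (suc d ℕ.* 1)
    cross = trans (ℤ.*-identityʳ _) (cong (λ c → + a ℤ.* + c) (sym (ℕ.*-identityʳ (suc d))))

  fromℕ-∑ : ∀ {m} (f : Fin m → ℕ) → fromℕ (∑ℕ f) ≡ ∑ℚ (fromℕ ∘ f)
  fromℕ-∑ {zero}  f = refl
  fromℕ-∑ {suc m} f = trans (fromℕ-+ (f zero) _) (cong (_+_ (fromℕ (f zero))) (fromℕ-∑ (f ∘ suc)))

  0≤fromℕ : ∀ a → 0ℚ ≤ fromℕ a
  0≤fromℕ a = ℚ.nonNegative⁻¹ _ {{ℚ.normalize-nonNeg a 1}}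

  instance
    fromℕ-nonZero : ∀ {d} .{{_ : NonZero d}} → ℚ.NonZero (fromℕ d)
    fromℕ-nonZero {suc d} = ℚ.pos⇒nonZero (fromℕ (suc d)) {{ℚ.normalize-pos (suc d) 1}}

  /≡fromℕ*1/ : ∀ a d .{{_ : NonZero d}} → + a / d ≡ fromℕ a * 1/ fromℕ d
  /≡fromℕ*1/ a d = begin
    + a / d                                  ≡⟨ ℚ.*-identityʳ (+ a / d) ⟨
    (+ a / d) * 1ℚ                           ≡⟨ cong ((+ a / d) *_) (ℚ.*-inverseʳ (fromℕ d)) ⟨
    (+ a / d) * (fromℕ d * 1/ fromℕ d)       ≡⟨ ℚ.*-assoc (+ a / d) (fromℕ d) _ ⟨
    ((+ a / d) * fromℕ d) * 1/ fromℕ d       ≡⟨ cong (_* 1/ fromℕ d) (/-*-fromℕ a d) ⟩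
    fromℕ a * 1/ fromℕ d                     ∎
    where open ≡-Reasoning

  /-*-/ : ∀ a b d e .{{_ : NonZero d}} .{{_ : NonZero e}} →
    (+ a / d) * (+ b / e) ≡ fromℕ (a ℕ.* b) * (1/ fromℕ d * 1/ fromℕ e)
  /-*-/ a b d e = begin
    (+ a / d) * (+ b / e)                             ≡⟨ cong₂ _*_ (/≡fromℕ*1/ a d) (/≡fromℕ*1/ b e) ⟩
    (fromℕ a * 1/ fromℕ d) * (fromℕ b * 1/ fromℕ e)   ≡⟨ ℚ*.interchange (fromℕ a) _ (fromℕ b) _ ⟩
    (fromℕ a * fromℕ b) * (1/ fromℕ d * 1/ fromℕ e)   ≡⟨ cong (_* _) (fromℕ-* a b) ⟨
    fromℕ (a ℕ.* b) * (1/ fromℕ d * 1/ fromℕ e)       ∎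
    where open ≡-Reasoning

  n/n≡1 : ∀ d .{{_ : NonZero d}} → + d / d ≡ 1ℚ
  n/n≡1 d = trans (/≡fromℕ*1/ d d) (ℚ.*-inverseʳ (fromℕ d))

  *-cancelˡ : ∀ p .{{_ : ℚ.NonZero p}} {q r} → p * q ≡ p * r → q ≡ r
  *-cancelˡ p {q} {r} pq≡pr = begin
    q                   ≡⟨ ℚ.*-identityˡ q ⟨
    1ℚ * q              ≡⟨ cong (_* q) (ℚ.*-inverseˡ p) ⟨
    (1/ p * p) * q      ≡⟨ ℚ.*-assoc (1/ p) p q ⟩
    1/ p * (p * q)      ≡⟨ cong (1/ p *_) pq≡pr ⟩
    1/ p * (p * r)      ≡⟨ ℚ.*-assoc (1/ p) p r ⟨
    (1/ p * p) * r      ≡⟨ cong (_* r) (ℚ.*-inverseˡ p) ⟩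
    1ℚ * r              ≡⟨ ℚ.*-identityˡ r ⟩
    r                   ∎
    where open ≡-Reasoning

  *≡1⇒≡1/ : ∀ p .{{_ : ℚ.NonZero p}} {q} → p * q ≡ 1ℚ → q ≡ 1/ p
  *≡1⇒≡1/ p pq≡1 = *-cancelˡ p (trans pq≡1 (sym (ℚ.*-inverseʳ p)))

  *1/≡⇒≡* : ∀ p .{{_ : ℚ.NonZero p}} {q r} → q * 1/ p ≡ r → q ≡ p * r
  *1/≡⇒≡* p {q} {r} q/p≡r = begin
    q                   ≡⟨ ℚ.*-identityʳ q ⟨
    q * 1ℚ              ≡⟨ cong (q *_) (ℚ.*-inverseˡ p) ⟨
    q * (1/ p * p)      ≡⟨ ℚ.*-assoc q (1/ p) p ⟨
    (q * 1/ p) * p      ≡⟨ cong (_* p) q/p≡r ⟩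
    r * p               ≡⟨ ℚ.*-comm r p ⟩
    p * r               ∎
    where open ≡-Reasoning

  ≤⇒0≤- : ∀ {p q} → p ≤ q → 0ℚ ≤ q - p
  ≤⇒0≤- {p} {q} p≤q = subst (_≤ q - p) (ℚ.+-inverseʳ p) (ℚ.+-monoˡ-≤ (ℚ.- p) p≤q)

  0≤* : ∀ {p q} → 0ℚ ≤ p → 0ℚ ≤ q → 0ℚ ≤ p * q
  0≤* {p} {q} 0≤p 0≤q = ℚ.nonNegative⁻¹ (p * q)
    {{ℚ.nonNeg*nonNeg⇒nonNeg p {{ℚ.nonNegative 0≤p}} q {{ℚ.nonNegative 0≤q}}}}

  ∑ℚ-nonNeg : ∀ {m} (f : Fin m → ℚ) → (∀ i → 0ℚ ≤ f i) → 0ℚ ≤ ∑ℚ f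
  ∑ℚ-nonNeg {zero}  f 0≤f = ℚ.≤-refl
  ∑ℚ-nonNeg {suc m} f 0≤f = ℚ.+-mono-≤ (0≤f zero) (∑ℚ-nonNeg (f ∘ suc) (0≤f ∘ suc))

  term≤∑ℚ : ∀ {m} (f : Fin m → ℚ) → (∀ i → 0ℚ ≤ f i) → ∀ i → f i ≤ ∑ℚ f
  term≤∑ℚ f 0≤f zero = subst (_≤ ∑ℚ f) (ℚ.+-identityʳ (f zero))
    (ℚ.+-monoʳ-≤ (f zero) (∑ℚ-nonNeg (f ∘ suc) (0≤f ∘ suc)))
  term≤∑ℚ f 0≤f (suc i) = ℚ.≤-trans (term≤∑ℚ (f ∘ suc) (0≤f ∘ suc) i)
    (subst (_≤ ∑ℚ f) (ℚ.+-identityˡ _) (ℚ.+-monoˡ-≤ (∑ℚ (f ∘ suc)) (0≤f zero)))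

  nonNeg-∑≡0 : ∀ {m} (f : Fin m → ℚ) → (∀ i → 0ℚ ≤ f i) → ∑ℚ f ≡ 0ℚ → ∀ i → f i ≡ 0ℚ
  nonNeg-∑≡0 f 0≤f ∑f≡0 i = ℚ.≤-antisym (subst (f i ≤_) ∑f≡0 (term≤∑ℚ f 0≤f i)) (0≤f i)

  IsHarmonic : ∀ {n} → (Fin n → Fin n → ℕ) → (Fin n → ℚ) → Set
  IsHarmonic W x = ∀ i → ∑ℚ (λ j → fromℕ (W i j) * x j) ≡ ∑ℚ (λ j → fromℕ (W i j)) * x i

  module _ {n} {W : Fin n → Fin n → ℕ} {x : Fin n → ℚ} (harmonic : IsHarmonic W x) where

    harmonic-max-spreads : ∀ {m} → (∀ l → x l ≤ x m) →
      ∀ {i j} → x i ≡ x m → 0 ℕ.< W i j → x j ≡ x m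
    harmonic-max-spreads {m} x≤xₘ {i} {j} xᵢ≡xₘ 0<Wᵢⱼ =
      sym (x∙y⁻¹≈ε⇒x≈y (x m) (x j) xₘ-xⱼ≡0)
      where
      -- At a maximum the gaps w_l (x_m − x_l) are nonnegative and sum to 0.
      w : Fin n → ℚ
      w l = fromℕ (W i l)
      gap : Fin n → ℚ
      gap l = w l * (x m - x l)
      a[b-c]+ac≡ab : ∀ a b c → a * (b - c) + a * c ≡ a * b
      a[b-c]+ac≡ab = solve 3 (λ a b c → a :* (b :- c) :+ a :* c := a :* b) refl
        where open Data.Rational.Solver.+-*-Solver
      ∑gap+∑wx≡∑wx : ∑ℚ gap + ∑ℚ (λ l → w l * x l) ≡ ∑ℚ (λ l → w l * x l)
      ∑gap+∑wx≡∑wx = begin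
        ∑ℚ gap + ∑ℚ (λ l → w l * x l)      ≡⟨ ℚΣ.∑-distrib-+ gap (λ l → w l * x l) ⟨
        ∑ℚ (λ l → gap l + w l * x l)       ≡⟨ ℚΣ.sum-cong-≗ (λ l → a[b-c]+ac≡ab (w l) (x m) (x l)) ⟩
        ∑ℚ (λ l → w l * x m)               ≡⟨ ℚΣ.*-distribʳ-sum (x m) w ⟨
        ∑ℚ w * x m                         ≡⟨ cong (∑ℚ w *_) xᵢ≡xₘ ⟨
        ∑ℚ w * x i                         ≡⟨ harmonic i ⟨
        ∑ℚ (λ l → w l * x l)               ∎
        where open ≡-Reasoning
      gapⱼ≡0 : gap j ≡ 0ℚ
      gapⱼ≡0 = nonNeg-∑≡0 gap (λ l → 0≤* (0≤fromℕ (W i l)) (≤⇒0≤- (x≤xₘ l)))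
        (+-identityˡ-unique (∑ℚ gap) _ ∑gap+∑wx≡∑wx) j
      xₘ-xⱼ≡0 : x m - x j ≡ 0ℚ
      xₘ-xⱼ≡0 = *-cancelˡ (w j) {{fromℕ-nonZero {{ℕ.>-nonZero 0<Wᵢⱼ}}}} (trans gapⱼ≡0 (sym (ℚ.*-zeroʳ (w j))))

    harmonic-constant : IsConnected W → ∀ i j → x i ≡ x j
    harmonic-constant connected i j = trans (at-max i) (sym (at-max j))
      where
      open Data.List.Extrema (DecTotalOrder.totalOrder ℚ.≤-decTotalOrder)
      m : Fin n
      m = argmax x i (allFin n)
      x≤xₘ : ∀ l → x l ≤ x m
      x≤xₘ l = lookup (f[xs]≤f[argmax] {f = x} i (allFin n)) (∈-allFin l)
      spread : ∀ {l l′} → Reach W l l′ → x l ≡ x m → x l′ ≡ x m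
      spread here              xₗ≡xₘ = xₗ≡xₘ
      spread (step 0<Wₗₗ′ path) xₗ≡xₘ = spread path (harmonic-max-spreads x≤xₘ xₗ≡xₘ 0<Wₗₗ′)
      at-max : ∀ l → x l ≡ x m
      at-max l = spread (connected m l) refl

  module ReversibleWalk {n} (B : Fin n → Fin n → ℕ) (k : ℕ) .{{_ : NonZero k}}
    (rowSum : ∀ i → ∑ℕ (B i) ≡ k)
    (μ : Fin n → ℕ) (reversible : ∀ i j → μ i ℕ.* B i j ≡ μ j ℕ.* B j i) where

    μ-invariant : ∀ j → ∑ℕ (λ i → μ i ℕ.* B i j) ≡ μ j ℕ.* k
    μ-invariant j = begin
      ∑ℕ (λ i → μ i ℕ.* B i j)   ≡⟨ ℕΣ.sum-cong-≗ (λ i → reversible i j) ⟩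
      ∑ℕ (λ i → μ j ℕ.* B j i)   ≡⟨ ℕΣ.*-distribˡ-sum (μ j) (B j) ⟨
      μ j ℕ.* ∑ℕ (B j)           ≡⟨ cong (μ j ℕ.*_) (rowSum j) ⟩
      μ j ℕ.* k                  ∎
      where open ≡-Reasoning

    module Density (μ≢0 : ∀ i → NonZero (μ i)) (π : Fin n → ℚ)
      (πP≡π : ∀ j → sumℚ (λ i → π i * transitionMatrix k B i j) ≡ π j) where

      μ⁻¹ : Fin n → ℚ
      μ⁻¹ i = 1/_ (fromℕ (μ i)) {{fromℕ-nonZero {{μ≢0 i}}}}

      density : Fin n → ℚ
      density i = π i * μ⁻¹ i

      π≡μ*density : ∀ i → π i ≡ fromℕ (μ i) * density i
      π≡μ*density i = begin
        π i                            ≡⟨ ℚ.*-identityʳ (π i) ⟨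
        π i * 1ℚ                       ≡⟨ cong (π i *_) (ℚ.*-inverseʳ (fromℕ (μ i)) {{fromℕ-nonZero {{μ≢0 i}}}}) ⟨
        π i * (fromℕ (μ i) * μ⁻¹ i)     ≡⟨ ℚ*.x∙yz≈y∙xz (π i) (fromℕ (μ i)) (μ⁻¹ i) ⟩
        fromℕ (μ i) * density i        ∎
        where open ≡-Reasoning

      density-harmonic : IsHarmonic B density
      density-harmonic j = begin
        S                                   ≡⟨ *1/≡⇒≡* (fromℕ k) S/k≡xⱼ ⟩
        fromℕ k * x j                       ≡⟨ cong (λ c → fromℕ c * x j) (rowSum j) ⟨
        fromℕ (∑ℕ (B j)) * x j              ≡⟨ cong (_* x j) (fromℕ-∑ (B j)) ⟩
        ∑ℚ (λ i → fromℕ (B j i)) * x j      ∎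
        where
        open ≡-Reasoning
        x : Fin n → ℚ
        x = density
        b : Fin n → Fin n → ℚ
        b i l = fromℕ (B i l)
        k⁻¹ : ℚ
        k⁻¹ = 1/ fromℕ k
        S : ℚ
        S = ∑ℚ (λ i → b j i * x i)
        flow : ∀ i → fromℕ (μ j) * ((b j i * x i) * k⁻¹) ≡ π i * transitionMatrix k B i j
        flow i = begin
          fromℕ (μ j) * ((b j i * x i) * k⁻¹)  ≡⟨ cong (fromℕ (μ j) *_) (ℚ.*-assoc (b j i) (x i) k⁻¹) ⟩
          fromℕ (μ j) * (b j i * (x i * k⁻¹))  ≡⟨ ℚ.*-assoc (fromℕ (μ j)) (b j i) _ ⟨
          (fromℕ (μ j) * b j i) * (x i * k⁻¹)  ≡⟨ cong (_* (x i * k⁻¹)) (trans (sym (fromℕ-* (μ j) (B j i)))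
                                                   (trans (cong fromℕ (reversible j i)) (fromℕ-* (μ i) (B i j)))) ⟩
          (fromℕ (μ i) * b i j) * (x i * k⁻¹)  ≡⟨ ℚ*.interchange (fromℕ (μ i)) (b i j) (x i) k⁻¹ ⟩
          (fromℕ (μ i) * x i) * (b i j * k⁻¹)  ≡⟨ cong₂ _*_ (π≡μ*density i) (/≡fromℕ*1/ (B i j) k) ⟨
          π i * transitionMatrix k B i j       ∎
        μⱼ*[S/k]≡μⱼ*xⱼ : fromℕ (μ j) * (S * k⁻¹) ≡ fromℕ (μ j) * x j
        μⱼ*[S/k]≡μⱼ*xⱼ = begin
          fromℕ (μ j) * (S * k⁻¹)                          ≡⟨ cong (fromℕ (μ j) *_) (ℚΣ.*-distribʳ-sum k⁻¹ (λ i → b j i * x i)) ⟩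
          fromℕ (μ j) * ∑ℚ (λ i → (b j i * x i) * k⁻¹)      ≡⟨ ℚΣ.*-distribˡ-sum (fromℕ (μ j)) (λ i → (b j i * x i) * k⁻¹) ⟩
          ∑ℚ (λ i → fromℕ (μ j) * ((b j i * x i) * k⁻¹))    ≡⟨ ℚΣ.sum-cong-≗ flow ⟩
          ∑ℚ (λ i → π i * transitionMatrix k B i j)        ≡⟨ sumℚ≡∑ℚ (λ i → π i * transitionMatrix k B i j) ⟨
          sumℚ (λ i → π i * transitionMatrix k B i j)      ≡⟨ πP≡π j ⟩
          π j                                              ≡⟨ π≡μ*density j ⟩
          fromℕ (μ j) * x j                                ∎
        S/k≡xⱼ : S * k⁻¹ ≡ x j
        S/k≡xⱼ = *-cancelˡ (fromℕ (μ j)) {{fromℕ-nonZero {{μ≢0 j}}}} μⱼ*[S/k]≡μⱼ*xⱼ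

    module _ {N} .{{_ : NonZero N}} (total : ∑ℕ μ ≡ N) where

      ∑ℚ-fromℕ-μ : ∑ℚ (fromℕ ∘ μ) ≡ fromℕ N
      ∑ℚ-fromℕ-μ = trans (sym (fromℕ-∑ μ)) (cong fromℕ total)

      stationary : IsStationary (transitionMatrix k B) (λ i → + μ i / N)
      stationary = (λ i → ℚ.nonNegative⁻¹ _ {{ℚ.normalize-nonNeg (μ i) N}}) , mass , balance
        where
        open ≡-Reasoning
        N⁻¹ k⁻¹ : ℚ
        N⁻¹ = 1/ fromℕ N
        k⁻¹ = 1/ fromℕ k
        mass : sumℚ (λ i → + μ i / N) ≡ 1ℚ
        mass = begin
          sumℚ (λ i → + μ i / N)             ≡⟨ sumℚ≡∑ℚ (λ i → + μ i / N) ⟩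
          ∑ℚ (λ i → + μ i / N)               ≡⟨ ℚΣ.sum-cong-≗ (λ i → /≡fromℕ*1/ (μ i) N) ⟩
          ∑ℚ (λ i → fromℕ (μ i) * N⁻¹)       ≡⟨ ℚΣ.*-distribʳ-sum N⁻¹ (fromℕ ∘ μ) ⟨
          ∑ℚ (fromℕ ∘ μ) * N⁻¹               ≡⟨ cong (_* N⁻¹) ∑ℚ-fromℕ-μ ⟩
          fromℕ N * N⁻¹                      ≡⟨ ℚ.*-inverseʳ (fromℕ N) ⟩
          1ℚ                                 ∎
        balance : ∀ j → sumℚ (λ i → (+ μ i / N) * (+ B i j / k)) ≡ + μ j / N
        balance j = begin
          sumℚ (λ i → (+ μ i / N) * (+ B i j / k))     ≡⟨ sumℚ≡∑ℚ (λ i → (+ μ i / N) * (+ B i j / k)) ⟩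
          ∑ℚ (λ i → (+ μ i / N) * (+ B i j / k))       ≡⟨ ℚΣ.sum-cong-≗ (λ i → /-*-/ (μ i) (B i j) N k) ⟩
          ∑ℚ (λ i → fromℕ (μ i ℕ.* B i j) * (N⁻¹ * k⁻¹)) ≡⟨ ℚΣ.*-distribʳ-sum (N⁻¹ * k⁻¹) (λ i → fromℕ (μ i ℕ.* B i j)) ⟨
          ∑ℚ (λ i → fromℕ (μ i ℕ.* B i j)) * (N⁻¹ * k⁻¹) ≡⟨ cong (_* (N⁻¹ * k⁻¹)) (fromℕ-∑ (λ i → μ i ℕ.* B i j)) ⟨
          fromℕ (∑ℕ (λ i → μ i ℕ.* B i j)) * (N⁻¹ * k⁻¹) ≡⟨ cong (λ c → fromℕ c * (N⁻¹ * k⁻¹)) (μ-invariant j) ⟩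
          fromℕ (μ j ℕ.* k) * (N⁻¹ * k⁻¹)              ≡⟨ /-*-/ (μ j) k N k ⟨
          (+ μ j / N) * (+ k / k)                      ≡⟨ cong ((+ μ j / N) *_) (n/n≡1 k) ⟩
          (+ μ j / N) * 1ℚ                             ≡⟨ ℚ.*-identityʳ (+ μ j / N) ⟩
          + μ j / N                                    ∎

      stationary-unique : (∀ i → NonZero (μ i)) → IsConnected B →
        ∀ π → IsStationary (transitionMatrix k B) π → ∀ i → π i ≡ + μ i / N
      stationary-unique μ≢0 connected π (_ , ∑π≡1 , πP≡π) i = begin
        π i                        ≡⟨ π≡μ*density i ⟩
        fromℕ (μ i) * density i    ≡⟨ cong (fromℕ (μ i) *_) (*≡1⇒≡1/ (fromℕ N) N*xᵢ≡1) ⟩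
        fromℕ (μ i) * 1/ fromℕ N   ≡⟨ /≡fromℕ*1/ (μ i) N ⟨
        + μ i / N                  ∎
        where
        open ≡-Reasoning
        open Density μ≢0 π πP≡π
        N*xᵢ≡1 : fromℕ N * density i ≡ 1ℚ
        N*xᵢ≡1 = begin
          fromℕ N * density i                    ≡⟨ cong (_* density i) ∑ℚ-fromℕ-μ ⟨
          ∑ℚ (fromℕ ∘ μ) * density i             ≡⟨ ℚΣ.*-distribʳ-sum (density i) (fromℕ ∘ μ) ⟩
          ∑ℚ (λ l → fromℕ (μ l) * density i)     ≡⟨ ℚΣ.sum-cong-≗ (λ l → cong (fromℕ (μ l) *_)
                                                      (harmonic-constant density-harmonic connected i l)) ⟩
          ∑ℚ (λ l → fromℕ (μ l) * density l)     ≡⟨ ℚΣ.sum-cong-≗ π≡μ*density ⟨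
          ∑ℚ π                                   ≡⟨ sumℚ≡∑ℚ π ⟨
          sumℚ π                                 ≡⟨ ∑π≡1 ⟩
          1ℚ                                     ∎

lemma3p2 : (N n k : ℕ) .{{_ : NonZero N}} .{{_ : NonZero k}}
    → (G : SimpleGraph N) → IsRegular G k
    → (𝒫 : Partition N n) → IsEquitable G 𝒫
    → IsConnected (quotientAdj G 𝒫)
    → IsStationary (transitionMatrix k (quotientAdj G 𝒫)) (λ i → (+ blockSize 𝒫 i) / N)
      × (∀ (π : Fin n → ℚ) → IsStationary (transitionMatrix k (quotientAdj G 𝒫)) π
           → ∀ i → π i ≡ (+ blockSize 𝒫 i) / N)
lemma3p2 N n k G regular 𝒫 equitable connected =
  stationary (∑ℕ-blockSize 𝒫) , stationary-unique (∑ℕ-blockSize 𝒫) (blockSize-nonZero 𝒫) connected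
  where
  open ReversibleWalk (quotientAdj G 𝒫) k (quotientAdj-rowSum G 𝒫 regular)
    (blockSize 𝒫) (quotientAdj-reversible G 𝒫 equitable)
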